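{- There exists a discrete probability distribution $F$ on $(0,1]$ such that every sample $X\sim F$ satisfies $X\ge 1/4$ and, for all sufficiently large $n$, \[ \mathbb{E}[\mathrm{BF}(I_n(F))] > \tfrac{11}{10}\,\mathbb{E}[\mathrm{OPT}(I_n(F))], \] where $I_n(F)=(X_1,\ldots,X_n)$ is a list of $n$ i.i.d. samples from $F$.
   Context: Bin packing: a list of items with sizes in $(0,1]$ must be assigned to unit-capacity bins so that each bin's total size is at most $1$. $\mathrm{OPT}(I)$ is the minimum number of bins needed to pack $I$. Best Fit ($\mathrm{BF}$) is the online algorithm that processes items in list order and packs the current item into the fullest already-open bin in which it fits, opening a new bin if it fits in none; $\mathrm{BF}(I)$ denotes the number of bins it uses. -}

module Defs where

open import Data.Bool using (Bool; true; false; if_then_else_; _∧_; _∨_)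
open import Data.Nat as ℕ using (ℕ; zero; suc)
open import Data.Integer using (+_)
open import Data.Fin using (Fin; _≟_)
open import Data.List as List using (List; []; _∷_; length; foldl; map; concatMap)
open import Data.Bool.ListAction using (any; all)
open import Data.List.Base using (allFin)
open import Data.Vec as Vec using (Vec; []; _∷_; toList; zip)
open import Data.Maybe using (Maybe; just; nothing)
open import Data.Product using (_×_; _,_; proj₁; proj₂)
open import Relation.Nullary.Decidable using (does)
open import Relation.Binary.PropositionalEquality using (_≡_)
open import Data.Rational as ℚ using (ℚ; 0ℚ; 1ℚ; _+_; _*_; _≤_; _<_; _≤ᵇ_; _/_)

-- Items are rational sizes; a bin is represented by its current load.

sumℚ : List ℚ → ℚ
sumℚ = List.foldr _+_ 0ℚ

bestLoad : ℚ → List ℚ → Maybe ℚ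
bestLoad x [] = nothing
bestLoad x (l ∷ ls) with (l + x) ≤ᵇ 1ℚ | bestLoad x ls
... | false | r      = r
... | true  | nothing = just l
... | true  | just m  = if m ≤ᵇ l then just l else just m

addTo : ℚ → ℚ → List ℚ → List ℚ
addTo l x [] = []
addTo l x (b ∷ bs) =
  if (b ≤ᵇ l) ∧ (l ≤ᵇ b) then (b + x) ∷ bs else b ∷ addTo l x bs

bfStep : List ℚ → ℚ → List ℚ
bfStep bins x with bestLoad x bins
... | just l  = addTo l x bins
... | nothing = bins List.++ (x ∷ [])

BF : List ℚ → ℕ
BF I = length (foldl bfStep [] I)

allVecs : ∀ {A : Set} → List A → (n : ℕ) → List (Vec A n)
allVecs xs zero    = [] ∷ []
allVecs xs (suc n) = concatMap (λ v → map (λ x → x ∷ v) xs) (allVecs xs n)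

binLoad : ∀ {k n} → Vec ℚ n → Vec (Fin k) n → Fin k → ℚ
binLoad []       []       b = 0ℚ
binLoad (x ∷ xs) (a ∷ as) b = (if does (a ≟ b) then x else 0ℚ) + binLoad xs as b

validPacking : ∀ {k n} → Vec ℚ n → Vec (Fin k) n → Bool
validPacking {k} I asg = all (λ b → binLoad I asg b ≤ᵇ 1ℚ) (allFin k)

packable : ∀ {n} → ℕ → Vec ℚ n → Bool
packable {n} k I = any (validPacking I) (allVecs (allFin k) n)

-- Least k ≥ start with k packable, searching `fuel` values; default = start+fuel.
searchOpt : ∀ {n} → Vec ℚ n → ℕ → ℕ → ℕ
searchOpt I start zero       = start
searchOpt I start (suc fuel) =
  if packable start I then start else searchOpt I (suc start) fuel

-- OPT(I): minimum number of unit bins needed to pack I. For items of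
-- size in (0,1] the value n is always achievable, so searching 0..n suffices.
OPT : ∀ {n} → Vec ℚ n → ℕ
OPT {n} I = searchOpt I 0 n

record FinDist : Set where
  field
    m      : ℕ
    val    : Fin m → ℚ
    prob   : Fin m → ℚ
    val>0  : ∀ i → 0ℚ < val i
    val≤1  : ∀ i → val i ≤ 1ℚ
    prob≥0 : ∀ i → 0ℚ ≤ prob i
    probΣ  : sumℚ (map prob (allFin m)) ≡ 1ℚ
open FinDist public

toℚ : ℕ → ℚ
toℚ k = + k / 1

productℚ : List ℚ → ℚ
productℚ = List.foldr _*_ 1ℚ

-- Expectation of g(I_n(F)) where I_n(F) = (X_1,…,X_n) are i.i.d. samples
-- from F: sum over all index sequences σ of Π prob(σ_j) · g(val ∘ σ).
E[_] : ∀ {n} → FinDist → (Vec ℚ n → ℕ) → ℚ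
E[_] {n} F g =
  sumℚ (map (λ σ → productℚ (toList (Vec.map (prob F) σ)) * toℚ (g (Vec.map (val F) σ)))
            (allVecs (allFin (m F)) n))

BFᵥ : ∀ {n} → Vec ℚ n → ℕ
BFᵥ I = BF (toList I)

-- The distribution has item sizes 9/20, 2/5 and 3/10 with probabilities 1/3, 2/9 and 4/9.
--
-- Every item is at least 3/10, so a bin loaded above 7/10 never receives another item.  Best Fit
-- is therefore driven by its open bins alone, whose configuration is a 9-state Markov chain in the
-- samples; a potential function on these states with drift 2147/5000 gives E[BF] ≥ 0.4294 n.
--
-- For OPT, pair the large items, give each medium item two small ones and put the remaining small
-- items three to a bin.  With a, b, c the numbers of large, medium and small items this yields
-- OPT ≤ a/2 + b + (c ∸ 2b)/3 + 7/6, and (c ∸ 2b) ≤ (c − 2b + 100)²/400 where c − 2b is a centred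
-- random walk of variance 4n/3, so E[OPT] ≤ 0.39 n + 19/2.  As 1.1 · 0.39 = 0.429 < 0.4294, the
-- factor 11/10 is beaten once n ≥ 30000.

module Submission where

open import Defs
open import Data.Nat as ℕ using (ℕ; zero; suc; _≤_; _∸_; ⌈_/2⌉)
import Data.Nat.Properties as ℕP
open import Data.Integer as ℤ using (+_)
import Data.Integer.Properties as ℤP
open import Data.Rational as ℚ using (ℚ; mkℚ; 0ℚ; 1ℚ; _+_; _*_; _<_; _≤ᵇ_; _/_; -_; _-_) renaming (_≤_ to _≤ℚ_)
import Data.Rational.Properties as ℚP
open import Data.Rational.Solver using (module +-*-Solver)
open +-*-Solver
open import Data.Nat.Coprimality using (1-coprimeTo) renaming (sym to coprime-sym)
open import Data.Fin using (Fin; zero; suc; _≟_; #_)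
open import Data.Fin.Properties using (all?)
import Data.List.Relation.Unary.Any as Any
open import Data.List.Relation.Unary.Any.Properties using (any⁺)
import Data.List.Relation.Unary.All as All
open import Data.List.Relation.Unary.All.Properties using (all⁻)
open import Data.List.Membership.Propositional using (_∈_)
open import Data.List.Membership.Propositional.Properties using (∈-allFin; ∈-map⁺; ∈-concatMap⁺)
open import Data.List.Relation.Binary.Permutation.Propositional as ↭ using (_↭_; ↭-sym)
open import Data.List.Relation.Binary.Permutation.Propositional.Properties using (shift)
open import Data.Sum using (inj₁; inj₂)
open import Data.Product using (Σ; ∃; _×_; _,_)
open import Data.List as List using (List; []; _∷_; map; _++_; concatMap; allFin)
open import Data.Vec as Vec using (Vec; []; _∷_; toList)
open import Data.Bool using (true; false; T; _∧_; if_then_else_)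
open import Data.Maybe using (just; nothing; maybe′)
open import Data.Empty using (⊥-elim)
open import Relation.Nullary using (¬_; Dec; yes; no; does)
open import Relation.Nullary.Decidable using (toWitness)
import Data.List.Properties as ListP
open import Function using (_∘_)
open import Data.Unit using (tt)
open import Relation.Binary.PropositionalEquality

private variable
  A Q Q′ X Y : Set

⌈_/3⌉ : ℕ → ℕ
⌈ 0 /3⌉                 = 0
⌈ 1 /3⌉                 = 1
⌈ 2 /3⌉                 = 1
⌈ suc (suc (suc c)) /3⌉ = suc ⌈ c /3⌉

⌈n/2⌉+⌈n/2⌉≤1+n : ∀ n → ⌈ n /2⌉ ℕ.+ ⌈ n /2⌉ ≤ suc n
⌈n/2⌉+⌈n/2⌉≤1+n n = ℕP.≤-trans (ℕP.+-monoʳ-≤ ⌈ n /2⌉ (ℕP.⌊n/2⌋≤⌈n/2⌉ (suc n))) (ℕP.≤-reflexive (ℕP.⌊n/2⌋+⌈n/2⌉≡n (suc n)))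

⌈n/3⌉*3≤2+n : ∀ n → ⌈ n /3⌉ ℕ.+ (⌈ n /3⌉ ℕ.+ ⌈ n /3⌉) ≤ 2 ℕ.+ n
⌈n/3⌉*3≤2+n 0                 = ℕ.z≤n
⌈n/3⌉*3≤2+n 1                 = ℕ.s≤s (ℕ.s≤s (ℕ.s≤s ℕ.z≤n))
⌈n/3⌉*3≤2+n 2                 = ℕ.s≤s (ℕ.s≤s (ℕ.s≤s ℕ.z≤n))
⌈n/3⌉*3≤2+n (suc (suc (suc n)))
  rewrite ℕP.+-suc ⌈ n /3⌉ ⌈ n /3⌉ | ℕP.+-suc ⌈ n /3⌉ (suc (⌈ n /3⌉ ℕ.+ ⌈ n /3⌉)) | ℕP.+-suc ⌈ n /3⌉ (⌈ n /3⌉ ℕ.+ ⌈ n /3⌉) =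
  ℕ.s≤s (ℕ.s≤s (ℕ.s≤s (⌈n/3⌉*3≤2+n n)))

toℚ≡mkℚ : ∀ k → toℚ k ≡ mkℚ (+ k) 0 (coprime-sym (1-coprimeTo k))
toℚ≡mkℚ k = ℚP.↥p/↧p≡p (mkℚ (+ k) 0 (coprime-sym (1-coprimeTo k)))

toℚ-+ : ∀ a b → toℚ (a ℕ.+ b) ≡ toℚ a + toℚ b
toℚ-+ a b rewrite toℚ≡mkℚ a | toℚ≡mkℚ b | ℤP.*-identityʳ (+ a) | ℤP.*-identityʳ (+ b) = refl

toℚ-mono : ∀ {a b} → a ≤ b → toℚ a ≤ℚ toℚ b
toℚ-mono {a} {b} a≤b rewrite toℚ≡mkℚ a | toℚ≡mkℚ b =
  ℚ.*≤* (subst₂ ℤ._≤_ (sym (ℤP.*-identityʳ (+ a))) (sym (ℤP.*-identityʳ (+ b))) (ℤ.+≤+ a≤b))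

*-monoˡ-≤-nonNeg : ∀ {r p q} → 0ℚ ≤ℚ r → p ≤ℚ q → r * p ≤ℚ r * q
*-monoˡ-≤-nonNeg {r} 0≤r = ℚP.*-monoˡ-≤-nonNeg r {{ℚ.nonNegative 0≤r}}

*-nonNeg : ∀ {p q} → 0ℚ ≤ℚ p → 0ℚ ≤ℚ q → 0ℚ ≤ℚ p * q
*-nonNeg {p} {q} 0≤p 0≤q =
  ℚP.nonNegative⁻¹ (p * q) {{ℚP.nonNeg*nonNeg⇒nonNeg p {{ℚ.nonNegative 0≤p}} q {{ℚ.nonNegative 0≤q}}}}

toℚ-≤-half : ∀ {x y} → x ℕ.+ x ≤ y → toℚ x ≤ℚ (+ 1 / 2) * toℚ y
toℚ-≤-half {x} {y} x+x≤y = begin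
  toℚ x                          ≡⟨ solve 1 (λ u → u := con (+ 1 / 2) :* (u :+ u)) refl (toℚ x) ⟩
  (+ 1 / 2) * (toℚ x + toℚ x)    ≡⟨ cong ((+ 1 / 2) *_) (sym (toℚ-+ x x)) ⟩
  (+ 1 / 2) * toℚ (x ℕ.+ x)      ≤⟨ *-monoˡ-≤-nonNeg {+ 1 / 2} (ℚP.≤ᵇ⇒≤ tt) (toℚ-mono x+x≤y) ⟩
  (+ 1 / 2) * toℚ y              ∎
  where open ℚP.≤-Reasoning

toℚ-≤-third : ∀ {x y} → x ℕ.+ (x ℕ.+ x) ≤ y → toℚ x ≤ℚ (+ 1 / 3) * toℚ y
toℚ-≤-third {x} {y} 3x≤y = begin
  toℚ x                                      ≡⟨ solve 1 (λ u → u := con (+ 1 / 3) :* (u :+ (u :+ u))) refl (toℚ x) ⟩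
  (+ 1 / 3) * (toℚ x + (toℚ x + toℚ x))      ≡⟨ cong (λ e → (+ 1 / 3) * e) (sym (trans (toℚ-+ x _) (cong (λ e → toℚ x + e) (toℚ-+ x x)))) ⟩
  (+ 1 / 3) * toℚ (x ℕ.+ (x ℕ.+ x))          ≤⟨ *-monoˡ-≤-nonNeg {+ 1 / 3} (ℚP.≤ᵇ⇒≤ tt) (toℚ-mono 3x≤y) ⟩
  (+ 1 / 3) * toℚ y                          ∎
  where open ℚP.≤-Reasoning

square-nonNeg : ∀ y → 0ℚ ≤ℚ y * y
square-nonNeg y with ℚP.≤-total 0ℚ y
... | inj₁ 0≤y = *-nonNeg 0≤y 0≤y
... | inj₂ y≤0 = subst (0ℚ ≤ℚ_) (solve 1 (λ u → (:- u) :* (:- u) := u :* u) refl y) (*-nonNeg 0≤-y 0≤-y)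
  where
  0≤-y : 0ℚ ≤ℚ - y
  0≤-y = ℚP.neg-antimono-≤ y≤0

-- (x + K)² = 4Kx + (x − K)².
∸-≤-square : ∀ K c d → (+ 4 / 1) * K * toℚ (c ∸ d) ≤ℚ (toℚ c - toℚ d + K) * (toℚ c - toℚ d + K)
∸-≤-square K c d with ℕP.≤-total c d
... | inj₁ c≤d rewrite ℕP.m≤n⇒m∸n≡0 c≤d =
  subst (_≤ℚ (toℚ c - toℚ d + K) * (toℚ c - toℚ d + K)) (sym (ℚP.*-zeroʳ ((+ 4 / 1) * K))) (square-nonNeg (toℚ c - toℚ d + K))
... | inj₂ d≤c = begin
  (+ 4 / 1) * K * D                                  ≡⟨ sym (ℚP.+-identityʳ _) ⟩
  (+ 4 / 1) * K * D + 0ℚ                             ≤⟨ ℚP.+-monoʳ-≤ ((+ 4 / 1) * K * D) (square-nonNeg (D - K)) ⟩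
  (+ 4 / 1) * K * D + (D - K) * (D - K)
    ≡⟨ solve 3 (λ k x y → con (+ 4 / 1) :* k :* x :+ (x :- k) :* (x :- k)
                         := (x :+ y :- y :+ k) :* (x :+ y :- y :+ k)) refl K D (toℚ d) ⟩
  (D + toℚ d - toℚ d + K) * (D + toℚ d - toℚ d + K) ≡⟨ cong (λ x → (x - toℚ d + K) * (x - toℚ d + K)) (sym c≡D+d) ⟩
  (toℚ c - toℚ d + K) * (toℚ c - toℚ d + K)          ∎
  where
  open ℚP.≤-Reasoning
  D : ℚ
  D = toℚ (c ∸ d)
  c≡D+d : toℚ c ≡ D + toℚ d
  c≡D+d = trans (cong toℚ (sym (ℕP.m∸n+n≡m d≤c))) (toℚ-+ (c ∸ d) d)

-- Finite sums and expectations

∑ : {X : Set} → List X → (X → ℚ) → ℚ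
∑ xs f = sumℚ (map f xs)

infixr 5 ∑
syntax ∑ xs (λ x → e) = ∑[ x ← xs ] e

∑-cong : ∀ (xs : List X) {f g : X → ℚ} → (∀ x → f x ≡ g x) → ∑ xs f ≡ ∑ xs g
∑-cong []       f≡g = refl
∑-cong (x ∷ xs) f≡g = cong₂ _+_ (f≡g x) (∑-cong xs f≡g)

∑-mono : ∀ (xs : List X) {f g : X → ℚ} → (∀ x → f x ≤ℚ g x) → ∑ xs f ≤ℚ ∑ xs g
∑-mono []       f≤g = ℚP.≤-refl
∑-mono (x ∷ xs) f≤g = ℚP.+-mono-≤ (f≤g x) (∑-mono xs f≤g)

∑-+ : ∀ (xs : List X) (f g : X → ℚ) → ∑[ x ← xs ] (f x + g x) ≡ ∑ xs f + ∑ xs g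
∑-+ []       f g = refl
∑-+ (x ∷ xs) f g rewrite ∑-+ xs f g =
  solve 4 (λ a b c d → (a :+ b) :+ (c :+ d) := (a :+ c) :+ (b :+ d)) refl (f x) (g x) (∑ xs f) (∑ xs g)

∑-*ˡ : ∀ (xs : List X) (c : ℚ) (f : X → ℚ) → ∑[ x ← xs ] (c * f x) ≡ c * ∑ xs f
∑-*ˡ []       c f = sym (ℚP.*-zeroʳ c)
∑-*ˡ (x ∷ xs) c f rewrite ∑-*ˡ xs c f = sym (ℚP.*-distribˡ-+ c (f x) (∑ xs f))

∑-zero : ∀ (xs : List X) → ∑[ x ← xs ] 0ℚ ≡ 0ℚ
∑-zero []       = refl
∑-zero (x ∷ xs) = trans (ℚP.+-identityˡ _) (∑-zero xs)

∑-++ : ∀ (xs ys : List X) (f : X → ℚ) → ∑ (xs ++ ys) f ≡ ∑ xs f + ∑ ys f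
∑-++ []       ys f = sym (ℚP.+-identityˡ _)
∑-++ (x ∷ xs) ys f rewrite ∑-++ xs ys f = sym (ℚP.+-assoc (f x) (∑ xs f) (∑ ys f))

∑-comm : ∀ (xs : List X) (ys : List Y) (f : X → Y → ℚ) →
         ∑[ x ← xs ] ∑[ y ← ys ] f x y ≡ ∑[ y ← ys ] ∑[ x ← xs ] f x y
∑-comm []       ys f = sym (∑-zero ys)
∑-comm (x ∷ xs) ys f rewrite ∑-comm xs ys f = sym (∑-+ ys (f x) (λ y → ∑[ x ← xs ] f x y))

∑-map : ∀ (g : Y → X) (ys : List Y) (f : X → ℚ) → ∑ (map g ys) f ≡ ∑[ y ← ys ] f (g y)
∑-map g []       f = refl
∑-map g (y ∷ ys) f = cong (λ z → f (g y) + z) (∑-map g ys f)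

∑-concatMap : ∀ (g : Y → List X) (ys : List Y) (f : X → ℚ) →
              ∑ (concatMap g ys) f ≡ ∑[ y ← ys ] ∑ (g y) f
∑-concatMap g []       f = refl
∑-concatMap g (y ∷ ys) f = trans (∑-++ (g y) (concatMap g ys) f) (cong (λ z → ∑ (g y) f + z) (∑-concatMap g ys f))

sampleSum : ∀ {n} → (A → ℚ) → Vec A n → ℚ
sampleSum ξ []      = 0ℚ
sampleSum ξ (k ∷ σ) = ξ k + sampleSum ξ σ

sampleSum-+ : ∀ {n} (f g : A → ℚ) (σ : Vec A n) → sampleSum (λ a → f a + g a) σ ≡ sampleSum f σ + sampleSum g σ
sampleSum-+ f g []      = refl
sampleSum-+ f g (a ∷ σ) rewrite sampleSum-+ f g σ =
  solve 4 (λ x y u v → (x :+ y) :+ (u :+ v) := (x :+ u) :+ (y :+ v)) refl (f a) (g a) (sampleSum f σ) (sampleSum g σ)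

sampleSum-*ˡ : ∀ {n} c (f : A → ℚ) (σ : Vec A n) → sampleSum (λ a → c * f a) σ ≡ c * sampleSum f σ
sampleSum-*ˡ c f []      = sym (ℚP.*-zeroʳ c)
sampleSum-*ˡ c f (a ∷ σ) rewrite sampleSum-*ˡ c f σ = sym (ℚP.*-distribˡ-+ c (f a) (sampleSum f σ))

occurrences : ∀ {m n} → Fin m → Vec (Fin m) n → ℕ
occurrences k = Vec.count (_≟ k)

indicator : ∀ {m} → Fin m → Fin m → ℚ
indicator k j = if does (j ≟ k) then 1ℚ else 0ℚ

toℚ-occurrences : ∀ {m n} (k : Fin m) (σ : Vec (Fin m) n) → toℚ (occurrences k σ) ≡ sampleSum (indicator k) σ
toℚ-occurrences k []      = refl
toℚ-occurrences k (j ∷ σ) with does (j ≟ k)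
... | true  = trans (toℚ-+ 1 (occurrences k σ)) (cong (λ e → 1ℚ + e) (toℚ-occurrences k σ))
... | false = trans (toℚ-occurrences k σ) (sym (ℚP.+-identityˡ (sampleSum (indicator k) σ)))

totalReward : ∀ {n} → (Q → A → Q) → (Q → A → ℕ) → Q → Vec A n → ℕ
totalReward next reward q []      = 0
totalReward next reward q (a ∷ σ) = reward q a ℕ.+ totalReward next reward (next q a) σ

totalReward-simulate : ∀ {next : Q → A → Q} {reward : Q → A → ℕ}
  {next′ : Q′ → A → Q′} {reward′ : Q′ → A → ℕ} (f : Q → Q′) →
  (∀ q a → next′ (f q) a ≡ f (next q a)) → (∀ q a → reward′ (f q) a ≡ reward q a) →
  ∀ {n} q (σ : Vec A n) → totalReward next′ reward′ (f q) σ ≡ totalReward next reward q σ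
totalReward-simulate f next-f reward-f q []      = refl
totalReward-simulate {next = next} {reward} f next-f reward-f q (a ∷ σ)
  rewrite next-f q a | reward-f q a = cong (reward q a ℕ.+_) (totalReward-simulate f next-f reward-f (next q a) σ)

module Sampling (F : FinDist) where

  Sample : ℕ → Set
  Sample = Vec (Fin (m F))

  mean : (Fin (m F) → ℚ) → ℚ
  mean f = ∑[ k ← allFin (m F) ] prob F k * f k

  weight : ∀ {n} → Sample n → ℚ
  weight σ = productℚ (toList (Vec.map (prob F) σ))

  𝔼 : (n : ℕ) → (Sample n → ℚ) → ℚ
  𝔼 n h = ∑[ σ ← allVecs (allFin (m F)) n ] weight σ * h σ

  mean-cong : ∀ {f g} → (∀ k → f k ≡ g k) → mean f ≡ mean g
  mean-cong f≡g = ∑-cong (allFin (m F)) (λ k → cong (prob F k *_) (f≡g k))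

  mean-mono : ∀ {f g} → (∀ k → f k ≤ℚ g k) → mean f ≤ℚ mean g
  mean-mono f≤g = ∑-mono (allFin (m F)) (λ k → *-monoˡ-≤-nonNeg (prob≥0 F k) (f≤g k))

  mean-+ : ∀ f g → mean (λ k → f k + g k) ≡ mean f + mean g
  mean-+ f g = trans (∑-cong (allFin (m F)) (λ k → ℚP.*-distribˡ-+ (prob F k) (f k) (g k)))
                     (∑-+ (allFin (m F)) (λ k → prob F k * f k) (λ k → prob F k * g k))

  mean-const : ∀ c → mean (λ _ → c) ≡ c
  mean-const c = begin
    ∑[ k ← allFin (m F) ] prob F k * c  ≡⟨ ∑-cong (allFin (m F)) (λ k → ℚP.*-comm (prob F k) c) ⟩
    ∑[ k ← allFin (m F) ] c * prob F k  ≡⟨ ∑-*ˡ (allFin (m F)) c (prob F) ⟩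
    c * ∑ (allFin (m F)) (prob F)       ≡⟨ cong (c *_) (probΣ F) ⟩
    c * 1ℚ                              ≡⟨ ℚP.*-identityʳ c ⟩
    c                                   ∎
    where open ≡-Reasoning

  mean-shift : ∀ c f → mean (λ k → c + f k) ≡ c + mean f
  mean-shift c f = trans (mean-+ (λ _ → c) f) (cong (_+ mean f) (mean-const c))

  weight-nonNeg : ∀ {n} (σ : Sample n) → 0ℚ ≤ℚ weight σ
  weight-nonNeg []      = ℚP.≤ᵇ⇒≤ tt
  weight-nonNeg (k ∷ σ) = *-nonNeg (prob≥0 F k) (weight-nonNeg σ)

  private
    samples : ∀ n → List (Sample n)
    samples = allVecs (allFin (m F))

  𝔼-cong : ∀ n {f g} → (∀ σ → f σ ≡ g σ) → 𝔼 n f ≡ 𝔼 n g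
  𝔼-cong n f≡g = ∑-cong (samples n) (λ σ → cong (weight σ *_) (f≡g σ))

  𝔼-mono : ∀ n {f g} → (∀ σ → f σ ≤ℚ g σ) → 𝔼 n f ≤ℚ 𝔼 n g
  𝔼-mono n f≤g = ∑-mono (samples n) (λ σ → *-monoˡ-≤-nonNeg (weight-nonNeg σ) (f≤g σ))

  𝔼-+ : ∀ n f g → 𝔼 n (λ σ → f σ + g σ) ≡ 𝔼 n f + 𝔼 n g
  𝔼-+ n f g = trans (∑-cong (samples n) (λ σ → ℚP.*-distribˡ-+ (weight σ) (f σ) (g σ)))
                    (∑-+ (samples n) (λ σ → weight σ * f σ) (λ σ → weight σ * g σ))

  𝔼-*ˡ : ∀ n c f → 𝔼 n (λ σ → c * f σ) ≡ c * 𝔼 n f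
  𝔼-*ˡ n c f = trans (∑-cong (samples n) (λ σ → solve 3 (λ w a b → w :* (a :* b) := a :* (w :* b)) refl (weight σ) c (f σ)))
                     (∑-*ˡ (samples n) c (λ σ → weight σ * f σ))

  𝔼-[] : ∀ h → 𝔼 0 h ≡ h []
  𝔼-[] h = trans (ℚP.+-identityʳ (1ℚ * h [])) (ℚP.*-identityˡ (h []))

  𝔼-mean : ∀ n (g : Fin (m F) → Sample n → ℚ) → 𝔼 n (λ σ → mean (λ k → g k σ)) ≡ mean (λ k → 𝔼 n (g k))
  𝔼-mean n g = begin
    ∑[ σ ← samples n ] weight σ * (∑[ k ← ks ] prob F k * g k σ)
      ≡⟨ ∑-cong (samples n) (λ σ → sym (∑-*ˡ ks (weight σ) (λ k → prob F k * g k σ))) ⟩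
    ∑[ σ ← samples n ] ∑[ k ← ks ] weight σ * (prob F k * g k σ)
      ≡⟨ ∑-comm (samples n) ks (λ σ k → weight σ * (prob F k * g k σ)) ⟩
    ∑[ k ← ks ] ∑[ σ ← samples n ] weight σ * (prob F k * g k σ)
      ≡⟨ ∑-cong ks (λ k → 𝔼-*ˡ n (prob F k) (g k)) ⟩
    ∑[ k ← ks ] prob F k * 𝔼 n (g k) ∎
    where
    open ≡-Reasoning
    ks : List (Fin (m F))
    ks = allFin (m F)

  𝔼-∷ : ∀ n h → 𝔼 (suc n) h ≡ mean (λ k → 𝔼 n (λ τ → h (k ∷ τ)))
  𝔼-∷ n h = begin
    𝔼 (suc n) h
      ≡⟨ ∑-concatMap (λ τ → map (_∷ τ) ks) (samples n) (λ σ → weight σ * h σ) ⟩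
    ∑[ τ ← samples n ] ∑ (map (_∷ τ) ks) (λ σ → weight σ * h σ)
      ≡⟨ ∑-cong (samples n) (λ τ → trans (∑-map (_∷ τ) ks (λ σ → weight σ * h σ)) (∑-cong ks (λ k → reorder k τ))) ⟩
    ∑[ τ ← samples n ] ∑[ k ← ks ] weight τ * (prob F k * h (k ∷ τ))
      ≡⟨ ∑-cong (samples n) (λ τ → ∑-*ˡ ks (weight τ) (λ k → prob F k * h (k ∷ τ))) ⟩
    𝔼 n (λ τ → mean (λ k → h (k ∷ τ)))
      ≡⟨ 𝔼-mean n (λ k τ → h (k ∷ τ)) ⟩
    mean (λ k → 𝔼 n (λ τ → h (k ∷ τ))) ∎
    where
    open ≡-Reasoning
    ks : List (Fin (m F))
    ks = allFin (m F)
    reorder : ∀ k τ → weight (k ∷ τ) * h (k ∷ τ) ≡ weight τ * (prob F k * h (k ∷ τ))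
    reorder k τ = solve 3 (λ p w x → (p :* w) :* x := w :* (p :* x)) refl (prob F k) (weight τ) (h (k ∷ τ))

  𝔼-const : ∀ n c → 𝔼 n (λ _ → c) ≡ c
  𝔼-const zero    c = 𝔼-[] (λ _ → c)
  𝔼-const (suc n) c = trans (𝔼-∷ n (λ _ → c)) (trans (mean-cong (λ _ → 𝔼-const n c)) (mean-const c))

  𝔼-shift : ∀ n c f → 𝔼 n (λ σ → c + f σ) ≡ c + 𝔼 n f
  𝔼-shift n c f = trans (𝔼-+ n (λ _ → c) f) (cong (_+ 𝔼 n f) (𝔼-const n c))

  𝔼-sampleSum : ∀ ξ n → 𝔼 n (sampleSum ξ) ≡ toℚ n * mean ξ
  𝔼-sampleSum ξ zero    = trans (𝔼-[] (sampleSum ξ)) (sym (ℚP.*-zeroˡ (mean ξ)))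
  𝔼-sampleSum ξ (suc n) = begin
    𝔼 (suc n) (sampleSum ξ)                          ≡⟨ 𝔼-∷ n (sampleSum ξ) ⟩
    mean (λ k → 𝔼 n (λ τ → ξ k + sampleSum ξ τ))     ≡⟨ mean-cong (λ k → 𝔼-shift n (ξ k) (sampleSum ξ)) ⟩
    mean (λ k → ξ k + 𝔼 n (sampleSum ξ))             ≡⟨ mean-cong (λ k → ℚP.+-comm (ξ k) _) ⟩
    mean (λ k → 𝔼 n (sampleSum ξ) + ξ k)             ≡⟨ mean-shift (𝔼 n (sampleSum ξ)) ξ ⟩
    𝔼 n (sampleSum ξ) + mean ξ                       ≡⟨ cong (_+ mean ξ) (𝔼-sampleSum ξ n) ⟩
    toℚ n * mean ξ + mean ξ                          ≡⟨ solve 2 (λ t μ → t :* μ :+ μ := (con 1ℚ :+ t) :* μ) refl (toℚ n) (mean ξ) ⟩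
    (1ℚ + toℚ n) * mean ξ                            ≡⟨ cong (_* mean ξ) (sym (toℚ-+ 1 n)) ⟩
    toℚ (suc n) * mean ξ                             ∎
    where open ≡-Reasoning

  𝔼-sampleSum² : ∀ ξ → mean ξ ≡ 0ℚ → ∀ n →
                 𝔼 n (λ σ → sampleSum ξ σ * sampleSum ξ σ) ≡ toℚ n * mean (λ k → ξ k * ξ k)
  𝔼-sampleSum² ξ centred zero    =
    trans (𝔼-[] (λ σ → sampleSum ξ σ * sampleSum ξ σ)) (sym (ℚP.*-zeroˡ (mean (λ k → ξ k * ξ k))))
  𝔼-sampleSum² ξ centred (suc n) = begin
    𝔼 (suc n) (λ σ → S σ * S σ)                          ≡⟨ 𝔼-∷ n (λ σ → S σ * S σ) ⟩
    mean (λ k → 𝔼 n (λ τ → (ξ k + S τ) * (ξ k + S τ)))   ≡⟨ mean-cong (λ k → square-step (ξ k)) ⟩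
    mean (λ k → ξ k * ξ k + V)                           ≡⟨ mean-+ (λ k → ξ k * ξ k) (λ _ → V) ⟩
    mean (λ k → ξ k * ξ k) + mean (λ _ → V)              ≡⟨ cong (λ e → ν + e) (trans (mean-const V) (𝔼-sampleSum² ξ centred n)) ⟩
    ν + toℚ n * ν                                        ≡⟨ solve 2 (λ ν t → ν :+ t :* ν := (con 1ℚ :+ t) :* ν) refl ν (toℚ n) ⟩
    (1ℚ + toℚ n) * ν                                     ≡⟨ cong (_* ν) (sym (toℚ-+ 1 n)) ⟩
    toℚ (suc n) * ν                                      ∎
    where
    open ≡-Reasoning
    S : ∀ {n} → Sample n → ℚ
    S = sampleSum ξ
    V ν : ℚ
    V = 𝔼 n (λ τ → S τ * S τ)
    ν = mean (λ k → ξ k * ξ k)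
    square-step : ∀ x → 𝔼 n (λ τ → (x + S τ) * (x + S τ)) ≡ x * x + V
    square-step x = begin
      𝔼 n (λ τ → (x + S τ) * (x + S τ))
        ≡⟨ 𝔼-cong n (λ τ → solve 2 (λ x s → (x :+ s) :* (x :+ s) := x :* x :+ ((x :+ x) :* s :+ s :* s)) refl x (S τ)) ⟩
      𝔼 n (λ τ → x * x + ((x + x) * S τ + S τ * S τ))
        ≡⟨ 𝔼-shift n (x * x) _ ⟩
      x * x + 𝔼 n (λ τ → (x + x) * S τ + S τ * S τ)
        ≡⟨ cong (λ e → x * x + e) (trans (𝔼-+ n _ _) (cong (_+ V) (𝔼-*ˡ n (x + x) S))) ⟩
      x * x + ((x + x) * 𝔼 n S + V)
        ≡⟨ cong (λ e → x * x + ((x + x) * e + V)) (trans (𝔼-sampleSum ξ n) (cong (toℚ n *_) centred)) ⟩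
      x * x + ((x + x) * (toℚ n * 0ℚ) + V)
        ≡⟨ solve 3 (λ x t v → x :* x :+ ((x :+ x) :* (t :* con 0ℚ) :+ v) := x :* x :+ v) refl x (toℚ n) V ⟩
      x * x + V ∎

  module _ {Q : Set} (next : Q → Fin (m F) → Q) (reward : Q → Fin (m F) → ℕ)
           (ρ : ℚ) (φ : Q → ℚ) (φ≤0 : ∀ q → φ q ≤ℚ 0ℚ)
           (drift : ∀ q → ρ + φ q ≤ℚ mean (λ k → toℚ (reward q k) + φ (next q k))) where

    𝔼-totalReward-≥ : ∀ n q → toℚ n * ρ + φ q ≤ℚ 𝔼 n (λ σ → toℚ (totalReward next reward q σ))
    𝔼-totalReward-≥ zero    q = begin
      toℚ 0 * ρ + φ q ≡⟨ cong (_+ φ q) (ℚP.*-zeroˡ ρ) ⟩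
      0ℚ + φ q        ≡⟨ ℚP.+-identityˡ (φ q) ⟩
      φ q             ≤⟨ φ≤0 q ⟩
      0ℚ              ≡⟨ sym (𝔼-[] (λ σ → toℚ (totalReward next reward q σ))) ⟩
      𝔼 0 (λ σ → toℚ (totalReward next reward q σ)) ∎
      where open ℚP.≤-Reasoning
    𝔼-totalReward-≥ (suc n) q = begin
      toℚ (suc n) * ρ + φ q
        ≡⟨ cong (λ t → t * ρ + φ q) (toℚ-+ 1 n) ⟩
      (1ℚ + toℚ n) * ρ + φ q
        ≡⟨ solve 3 (λ t r f → (con 1ℚ :+ t) :* r :+ f := t :* r :+ (r :+ f)) refl (toℚ n) ρ (φ q) ⟩
      toℚ n * ρ + (ρ + φ q)
        ≤⟨ ℚP.+-monoʳ-≤ (toℚ n * ρ) (drift q) ⟩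
      toℚ n * ρ + mean (λ k → r k + φ (next q k))
        ≡⟨ sym (mean-shift (toℚ n * ρ) _) ⟩
      mean (λ k → toℚ n * ρ + (r k + φ (next q k)))
        ≡⟨ mean-cong (λ k → solve 3 (λ a b c → a :+ (b :+ c) := b :+ (a :+ c)) refl (toℚ n * ρ) (r k) (φ (next q k))) ⟩
      mean (λ k → r k + (toℚ n * ρ + φ (next q k)))
        ≤⟨ mean-mono (λ k → ℚP.+-monoʳ-≤ (r k) (𝔼-totalReward-≥ n (next q k))) ⟩
      mean (λ k → r k + V n (next q k))
        ≡⟨ mean-cong (λ k → sym (trans (𝔼-cong n (λ τ → toℚ-+ (reward q k) _)) (𝔼-shift n (r k) _))) ⟩
      mean (λ k → 𝔼 n (λ τ → toℚ (totalReward next reward q (k ∷ τ))))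
        ≡⟨ sym (𝔼-∷ n _) ⟩
      V (suc n) q ∎
      where
      open ℚP.≤-Reasoning
      r : Fin (m F) → ℚ
      r k = toℚ (reward q k)
      V : ∀ n → Q → ℚ
      V n q = 𝔼 n (λ σ → toℚ (totalReward next reward q σ))

-- Best Fit

bestLoad-fits : ∀ x bins {l} → bestLoad x bins ≡ just l → l + x ≤ℚ 1ℚ
bestLoad-fits x (b ∷ bs) eq with (b + x) ≤ᵇ 1ℚ in fit | bestLoad x bs in rest
... | false | _       = bestLoad-fits x bs (trans rest eq)
... | true  | nothing with refl ← eq = ℚP.≤ᵇ⇒≤ (subst T (sym fit) tt)
... | true  | just c with c ≤ᵇ b
...   | true  with refl ← eq = ℚP.≤ᵇ⇒≤ (subst T (sym fit) tt)
...   | false with refl ← eq = bestLoad-fits x bs rest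

bestLoad-skip : ∀ x b bs → ¬ (b + x ≤ℚ 1ℚ) → bestLoad x (b ∷ bs) ≡ bestLoad x bs
bestLoad-skip x b bs no-fit with (b + x) ≤ᵇ 1ℚ in fit
... | true  = ⊥-elim (no-fit (ℚP.≤ᵇ⇒≤ (subst T (sym fit) tt)))
... | false = refl

length-addTo : ∀ l x bins → List.length (addTo l x bins) ≡ List.length bins
length-addTo l x []       = refl
length-addTo l x (b ∷ bs) with (b ≤ᵇ l) ∧ (l ≤ᵇ b)
... | true  = refl
... | false = cong suc (length-addTo l x bs)

addTo-target : ∀ b l → ((b ≤ᵇ l) ∧ (l ≤ᵇ b)) ≡ true → b ≡ l
addTo-target b l eq with b ≤ᵇ l in b≤l | l ≤ᵇ b in l≤b
addTo-target b l refl | true | true =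
  ℚP.≤-antisym (ℚP.≤ᵇ⇒≤ (subst T (sym b≤l) tt)) (ℚP.≤ᵇ⇒≤ (subst T (sym l≤b) tt))

opened : List ℚ → ℚ → ℕ
opened bins x = maybe′ (λ _ → 0) 1 (bestLoad x bins)

length-bfStep : ∀ bins x → List.length (bfStep bins x) ≡ List.length bins ℕ.+ opened bins x
length-bfStep bins x with bestLoad x bins
... | just l  = trans (length-addTo l x bins) (sym (ℕP.+-identityʳ _))
... | nothing = ListP.length-++ bins

-- A bin loaded above 1 − s can take no further item of size ≥ s, so on such items Best Fit's
-- choices and the number of bins it opens depend only on the open bins.
module OpenBins (s : ℚ) where

  isOpen? : ∀ l → Dec (l ≤ℚ 1ℚ - s)
  isOpen? l = l ℚP.≤? 1ℚ - s

  openBins : List ℚ → List ℚ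
  openBins = List.filter isOpen?

  fits⇒open : ∀ {l x} → s ≤ℚ x → l + x ≤ℚ 1ℚ → l ≤ℚ 1ℚ - s
  fits⇒open {l} s≤x fit = subst (_≤ℚ 1ℚ - s) (solve 2 (λ l s → l :+ s :- s := l) refl l s)
    (ℚP.+-monoˡ-≤ (- s) (ℚP.≤-trans (ℚP.+-monoʳ-≤ l s≤x) fit))

  openBins-absorbˡ : ∀ xs ys → openBins (openBins xs ++ ys) ≡ openBins (xs ++ ys)
  openBins-absorbˡ xs ys = begin
    openBins (openBins xs ++ ys)          ≡⟨ ListP.filter-++ isOpen? (openBins xs) ys ⟩
    openBins (openBins xs) ++ openBins ys ≡⟨ cong (_++ openBins ys) (ListP.filter-idem isOpen? xs) ⟩
    openBins xs ++ openBins ys            ≡⟨ sym (ListP.filter-++ isOpen? xs ys) ⟩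
    openBins (xs ++ ys)                   ∎
    where open ≡-Reasoning

  openBins-absorbʳ : ∀ xs ys → openBins (xs ++ openBins ys) ≡ openBins (xs ++ ys)
  openBins-absorbʳ xs ys = begin
    openBins (xs ++ openBins ys)          ≡⟨ ListP.filter-++ isOpen? xs (openBins ys) ⟩
    openBins xs ++ openBins (openBins ys) ≡⟨ cong (openBins xs ++_) (ListP.filter-idem isOpen? ys) ⟩
    openBins xs ++ openBins ys            ≡⟨ sym (ListP.filter-++ isOpen? xs ys) ⟩
    openBins (xs ++ ys)                   ∎
    where open ≡-Reasoning

  bestLoad-openBins : ∀ {x} → s ≤ℚ x → ∀ bins → bestLoad x (openBins bins) ≡ bestLoad x bins
  bestLoad-openBins s≤x []       = refl
  bestLoad-openBins {x} s≤x (b ∷ bs) with isOpen? b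
  ... | yes b-open rewrite ListP.filter-accept isOpen? {xs = bs} b-open | bestLoad-openBins s≤x bs = refl
  ... | no b-closed rewrite ListP.filter-reject isOpen? {xs = bs} b-closed =
    trans (bestLoad-openBins s≤x bs) (sym (bestLoad-skip x b bs (b-closed ∘ fits⇒open s≤x)))

  addTo-openBins : ∀ {l} x → l ≤ℚ 1ℚ - s → ∀ bins → openBins (addTo l x (openBins bins)) ≡ openBins (addTo l x bins)
  addTo-openBins     x l-open []       = refl
  addTo-openBins {l} x l-open (b ∷ bs) with isOpen? b
  ... | yes b-open rewrite ListP.filter-accept isOpen? {xs = bs} b-open with (b ≤ᵇ l) ∧ (l ≤ᵇ b)
  ...   | true  = openBins-absorbʳ ((b + x) ∷ []) bs
  ...   | false rewrite ListP.filter-accept isOpen? {xs = addTo l x (openBins bs)} b-open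
                      | ListP.filter-accept isOpen? {xs = addTo l x bs} b-open = cong (b ∷_) (addTo-openBins x l-open bs)
  addTo-openBins {l} x l-open (b ∷ bs) | no b-closed rewrite ListP.filter-reject isOpen? {xs = bs} b-closed
    with (b ≤ᵇ l) ∧ (l ≤ᵇ b) in target
  ... | true  = ⊥-elim (b-closed (subst (_≤ℚ 1ℚ - s) (sym (addTo-target b l target)) l-open))
  ... | false rewrite ListP.filter-reject isOpen? {xs = addTo l x bs} b-closed = addTo-openBins x l-open bs

  openBins-bfStep : ∀ {x} → s ≤ℚ x → ∀ bins → openBins (bfStep (openBins bins) x) ≡ openBins (bfStep bins x)
  openBins-bfStep {x} s≤x bins with bestLoad x (openBins bins) | bestLoad x bins in best | bestLoad-openBins s≤x bins
  ... | just l  | .(just l) | refl = addTo-openBins x (fits⇒open s≤x (bestLoad-fits x bins best)) bins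
  ... | nothing | .nothing  | refl = openBins-absorbˡ bins (x ∷ [])

  openStep : List ℚ → ℚ → List ℚ
  openStep o x = openBins (bfStep o x)

  opened-openBins : ∀ {x} → s ≤ℚ x → ∀ bins → opened (openBins bins) x ≡ opened bins x
  opened-openBins s≤x bins = cong (maybe′ (λ _ → 0) 1) (bestLoad-openBins s≤x bins)

  length-foldl-bfStep : ∀ (v : A → ℚ) → (∀ a → s ≤ℚ v a) → ∀ {n} bins (σ : Vec A n) →
    List.length (List.foldl bfStep bins (toList (Vec.map v σ)))
      ≡ List.length bins ℕ.+ totalReward (λ o a → openStep o (v a)) (λ o a → opened o (v a)) (openBins bins) σ
  length-foldl-bfStep v s≤v bins []      = sym (ℕP.+-identityʳ _)
  length-foldl-bfStep v s≤v bins (a ∷ σ)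
    rewrite length-foldl-bfStep v s≤v (bfStep bins (v a)) σ
          | length-bfStep bins (v a)
          | opened-openBins (s≤v a) bins
          | openBins-bfStep (s≤v a) bins
    = ℕP.+-assoc (List.length bins) (opened bins (v a)) _

searchOpt-≤ : ∀ {n} (I : Vec ℚ n) {s k} fuel → s ≤ k → T (packable k I) → searchOpt I s fuel ≤ k
searchOpt-≤ I     zero       s≤k k-packs = s≤k
searchOpt-≤ I {s} (suc fuel) s≤k k-packs with packable s I in s-packs
... | true  = s≤k
... | false with ℕP.m≤n⇒m<n∨m≡n s≤k
...   | inj₁ s<k  = searchOpt-≤ I fuel s<k k-packs
...   | inj₂ refl = ⊥-elim (subst T s-packs k-packs)

∈-allVecs : ∀ {k n} (v : Vec (Fin k) n) → v ∈ allVecs (allFin k) n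
∈-allVecs []      = Any.here refl
∈-allVecs {k} (a ∷ v) = ∈-concatMap⁺ (λ w → map (_∷ w) (allFin k)) (Any.map (λ { refl → ∈-map⁺ (_∷ v) (∈-allFin a) }) (∈-allVecs v))

OPT-≤-assignment : ∀ {k n} (I : Vec ℚ n) (asg : Vec (Fin k) n) → (∀ b → binLoad I asg b ≤ℚ 1ℚ) → OPT I ≤ k
OPT-≤-assignment {k} {n} I asg fits = searchOpt-≤ I n ℕ.z≤n
  (any⁺ (validPacking I) (Any.map (λ { refl → all⁻ _ (All.universal (λ b → ℚP.≤⇒≤ᵇ (fits b)) (allFin k)) }) (∈-allVecs asg)))

share : ∀ {k} → Fin k → Fin k → ℚ → ℚ
share a b x = if does (a ≟ b) then x else 0ℚ

listLoad : ∀ {k} → List ℚ → List (Fin k) → Fin k → ℚ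
listLoad (x ∷ xs) (a ∷ as) b = share a b x + listLoad xs as b
listLoad _        _        b = 0ℚ

-- Unlike the vector assignments in packable, these list assignments can be transported along
-- permutations of the items and extended by a new bin.
record Packing (k : ℕ) (xs : List ℚ) : Set where
  constructor packing
  field
    assignment : List (Fin k)
    length≡    : List.length assignment ≡ List.length xs
    fits       : ∀ b → listLoad xs assignment b ≤ℚ 1ℚ

OPT-≤-Packing : ∀ {k n} (I : Vec ℚ n) → Packing k (toList I) → OPT I ≤ k
OPT-≤-Packing {k} I (packing as len fits) with toVec I as len
  where
  toVec : ∀ {n} (I : Vec ℚ n) (as : List (Fin k)) → List.length as ≡ List.length (toList I) →
          Σ (Vec (Fin k) n) λ asg → ∀ b → binLoad I asg b ≡ listLoad (toList I) as b
  toVec []      []       _   = [] , λ _ → refl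
  toVec (x ∷ I) (a ∷ as) len with toVec I as (ℕP.suc-injective len)
  ... | asg , same = (a ∷ asg) , λ b → cong (λ e → share a b x + e) (same b)
... | asg , same = OPT-≤-assignment I asg (λ b → subst (_≤ℚ 1ℚ) (sym (same b)) (fits b))

Packing-↭ : ∀ {k xs ys} → xs ↭ ys → Packing k xs → Packing k ys
Packing-↭ {k} xs↭ys (packing as len fits) with permute xs↭ys as len
  where
  permute : ∀ {xs ys} → xs ↭ ys → (as : List (Fin k)) → List.length as ≡ List.length xs →
            Σ (List (Fin k)) λ bs → List.length bs ≡ List.length ys × (∀ b → listLoad ys bs b ≡ listLoad xs as b)
  permute ↭.refl as len = as , len , λ _ → refl
  permute (↭.prep x p) (a ∷ as) len with permute p as (ℕP.suc-injective len)
  ... | bs , len′ , same = a ∷ bs , cong suc len′ , λ b → cong (λ e → share a b x + e) (same b)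
  permute (↭.swap {xs} x y p) (a ∷ a′ ∷ as) len with permute p as (ℕP.suc-injective (ℕP.suc-injective len))
  ... | bs , len′ , same = a′ ∷ a ∷ bs , cong (λ l → suc (suc l)) len′ , λ b →
    trans (cong (λ e → share a′ b y + (share a b x + e)) (same b))
          (solve 3 (λ u v w → u :+ (v :+ w) := v :+ (u :+ w)) refl (share a′ b y) (share a b x) (listLoad xs as b))
  permute (↭.trans p q) as len with permute p as len
  ... | bs , len′ , same with permute q bs len′
  ...   | cs , len″ , same′ = cs , len″ , λ b → trans (same′ b) (same b)
... | bs , len′ , same = packing bs len′ (λ b → subst (_≤ℚ 1ℚ) (sym (same b)) (fits b))

Packing-[] : Packing 0 []
Packing-[] = packing [] refl λ ()

listLoad-++ : ∀ {k} xs ys (as bs : List (Fin k)) b → List.length as ≡ List.length xs →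
              listLoad (xs ++ ys) (as ++ bs) b ≡ listLoad xs as b + listLoad ys bs b
listLoad-++ []       ys []       bs b len = sym (ℚP.+-identityˡ _)
listLoad-++ (x ∷ xs) ys (a ∷ as) bs b len =
  trans (cong (λ e → share a b x + e) (listLoad-++ xs ys as bs b (ℕP.suc-injective len)))
        (sym (ℚP.+-assoc (share a b x) _ _))

listLoad-replicate-zero : ∀ {k} xs → listLoad {suc k} xs (List.replicate (List.length xs) zero) zero ≡ sumℚ xs
listLoad-replicate-zero []       = refl
listLoad-replicate-zero (x ∷ xs) = cong (λ e → x + e) (listLoad-replicate-zero xs)

listLoad-replicate-suc : ∀ {k} xs (b : Fin k) → listLoad xs (List.replicate (List.length xs) zero) (suc b) ≡ 0ℚ
listLoad-replicate-suc []       b = refl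
listLoad-replicate-suc (x ∷ xs) b = trans (ℚP.+-identityˡ _) (listLoad-replicate-suc xs b)

listLoad-map-suc-zero : ∀ {k} xs (as : List (Fin k)) → listLoad xs (map suc as) zero ≡ 0ℚ
listLoad-map-suc-zero []       as       = refl
listLoad-map-suc-zero (x ∷ xs) []       = refl
listLoad-map-suc-zero (x ∷ xs) (a ∷ as) = trans (ℚP.+-identityˡ _) (listLoad-map-suc-zero xs as)

listLoad-map-suc : ∀ {k} xs (as : List (Fin k)) b → listLoad xs (map suc as) (suc b) ≡ listLoad xs as b
listLoad-map-suc []       as       b = refl
listLoad-map-suc (x ∷ xs) []       b = refl
listLoad-map-suc (x ∷ xs) (a ∷ as) b = cong (λ e → share a b x + e) (listLoad-map-suc xs as b)

Packing-bin : ∀ {k xs} bin → sumℚ bin ≤ℚ 1ℚ → Packing k xs → Packing (suc k) (bin ++ xs)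
Packing-bin {k} {xs} bin bin-fits (packing as len fits) = packing (new ++ map suc as) len′ fits′
  where
  new : List (Fin (suc k))
  new = List.replicate (List.length bin) zero
  new-len : List.length new ≡ List.length bin
  new-len = ListP.length-replicate (List.length bin)
  len′ : List.length (new ++ map suc as) ≡ List.length (bin ++ xs)
  len′ = begin
    List.length (new ++ map suc as)                  ≡⟨ ListP.length-++ new ⟩
    List.length new ℕ.+ List.length (map suc as)     ≡⟨ cong₂ ℕ._+_ new-len (trans (ListP.length-map suc as) len) ⟩
    List.length bin ℕ.+ List.length xs               ≡⟨ sym (ListP.length-++ bin) ⟩
    List.length (bin ++ xs)                          ∎
    where open ≡-Reasoning
  fits′ : ∀ b → listLoad (bin ++ xs) (new ++ map suc as) b ≤ℚ 1ℚ
  fits′ zero    = subst (_≤ℚ 1ℚ) (sym (trans (listLoad-++ bin xs new (map suc as) zero new-len)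
                    (trans (cong₂ _+_ (listLoad-replicate-zero bin) (listLoad-map-suc-zero xs as)) (ℚP.+-identityʳ _)))) bin-fits
  fits′ (suc b) = subst (_≤ℚ 1ℚ) (sym (trans (listLoad-++ bin xs new (map suc as) (suc b) new-len)
                    (trans (cong₂ _+_ (listLoad-replicate-suc bin b) (listLoad-map-suc xs as b)) (ℚP.+-identityˡ _)))) (fits b)

-- The distribution and Best Fit

pattern large  = zero
pattern medium = suc zero
pattern small  = suc (suc zero)

size : Fin 3 → ℚ
size large  = + 9 / 20
size medium = + 2 / 5
size small  = + 3 / 10

probability : Fin 3 → ℚ
probability large  = + 1 / 3
probability medium = + 2 / 9
probability small  = + 4 / 9

quarter≤size : ∀ k → + 1 / 4 ≤ℚ size k
quarter≤size large  = ℚP.≤ᵇ⇒≤ tt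
quarter≤size medium = ℚP.≤ᵇ⇒≤ tt
quarter≤size small  = ℚP.≤ᵇ⇒≤ tt

𝓕 : FinDist
𝓕 = record
  { m      = 3
  ; val    = size
  ; prob   = probability
  ; val>0  = λ k → ℚP.<-≤-trans (toWitness {a? = 0ℚ ℚP.<? + 1 / 4} tt) (quarter≤size k)
  ; val≤1  = λ { large → ℚP.≤ᵇ⇒≤ tt ; medium → ℚP.≤ᵇ⇒≤ tt ; small → ℚP.≤ᵇ⇒≤ tt }
  ; prob≥0 = λ { large → ℚP.≤ᵇ⇒≤ tt ; medium → ℚP.≤ᵇ⇒≤ tt ; small → ℚP.≤ᵇ⇒≤ tt }
  ; probΣ  = refl
  }

-- A state of the chain lists the loads of Best Fit's open bins, in bin order.
openConfiguration : Fin 9 → List ℚ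
openConfiguration = Vec.lookup
  ( []
  ∷ (+ 9 / 20 ∷ [])
  ∷ (+ 2 / 5 ∷ [])
  ∷ (+ 3 / 10 ∷ [])
  ∷ (+ 7 / 10 ∷ [])
  ∷ (+ 3 / 5 ∷ [])
  ∷ (+ 7 / 10 ∷ + 9 / 20 ∷ [])
  ∷ (+ 7 / 10 ∷ + 2 / 5 ∷ [])
  ∷ (+ 3 / 5 ∷ + 9 / 20 ∷ [])
  ∷ [] )

transition : Fin 9 → Fin 3 → Fin 9
transition q = Vec.lookup (Vec.lookup table q)
  where
  table : Vec (Vec (Fin 9) 3) 9
  table = (# 1 ∷ # 2 ∷ # 3 ∷ [])
        ∷ (# 0 ∷ # 0 ∷ # 0 ∷ [])
        ∷ (# 0 ∷ # 0 ∷ # 4 ∷ [])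
        ∷ (# 0 ∷ # 4 ∷ # 5 ∷ [])
        ∷ (# 6 ∷ # 7 ∷ # 0 ∷ [])
        ∷ (# 8 ∷ # 0 ∷ # 0 ∷ [])
        ∷ (# 4 ∷ # 4 ∷ # 1 ∷ [])
        ∷ (# 4 ∷ # 4 ∷ # 2 ∷ [])
        ∷ (# 5 ∷ # 1 ∷ # 1 ∷ [])
        ∷ []

open OpenBins (size small)
open Sampling 𝓕

newBins : Fin 9 → Fin 3 → ℕ
newBins q k = opened (openConfiguration q) (size k)

transition-correct : ∀ q k → openStep (openConfiguration q) (size k) ≡ openConfiguration (transition q k)
transition-correct = toWitness {a? = all? λ q → all? λ k →
  ListP.≡-dec ℚP._≟_ (openStep (openConfiguration q) (size k)) (openConfiguration (transition q k))} tt

potential : Fin 9 → ℚ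
potential = Vec.lookup
  ( 0ℚ ∷ - (+ 859 / 2000) ∷ - (+ 1159 / 2000) ∷ - (+ 3359 / 5000) ∷ - (+ 27 / 80)
  ∷ - (+ 1883 / 5000) ∷ - (+ 8079 / 10000) ∷ - (+ 1749 / 2000) ∷ - (+ 8413 / 10000) ∷ [] )

bfRate : ℚ
bfRate = + 2147 / 5000

potential≤0 : ∀ q → potential q ≤ℚ 0ℚ
potential≤0 = toWitness {a? = all? λ q → potential q ℚP.≤? 0ℚ} tt

potential-drift : ∀ q → bfRate + potential q ≤ℚ mean (λ k → toℚ (newBins q k) + potential (transition q k))
potential-drift = toWitness {a? = all? λ q → bfRate + potential q ℚP.≤? mean (λ k → toℚ (newBins q k) + potential (transition q k))} tt

small≤size : ∀ k → size small ≤ℚ size k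
small≤size large  = ℚP.≤ᵇ⇒≤ tt
small≤size medium = ℚP.≤ᵇ⇒≤ tt
small≤size small  = ℚP.≤-refl

BF≡totalReward : ∀ {n} (σ : Sample n) → BFᵥ (Vec.map size σ) ≡ totalReward transition newBins zero σ
BF≡totalReward σ = trans (length-foldl-bfStep size small≤size [] σ)
  (totalReward-simulate openConfiguration (λ q k → transition-correct q k) (λ _ _ → refl) zero σ)

E[BF]-≥ : ∀ n → toℚ n * bfRate ≤ℚ E[_] {n} 𝓕 BFᵥ
E[BF]-≥ n = begin
  toℚ n * bfRate                                               ≡⟨ sym (ℚP.+-identityʳ _) ⟩
  toℚ n * bfRate + potential zero                              ≤⟨ 𝔼-totalReward-≥ transition newBins bfRate potential potential≤0 potential-drift n zero ⟩
  𝔼 n (λ σ → toℚ (totalReward transition newBins zero σ))     ≡⟨ 𝔼-cong n (λ σ → cong toℚ (sym (BF≡totalReward σ))) ⟩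
  E[_] {n} 𝓕 BFᵥ                                              ∎
  where open ℚP.≤-Reasoning

-- OPT

-- Each medium item shares its bin with up to two small ones; leftover small items go three to a bin.
mediumSmallBins : ℕ → ℕ → ℕ
mediumSmallBins 0       c             = ⌈ c /3⌉
mediumSmallBins (suc b) 0             = suc (mediumSmallBins b 0)
mediumSmallBins (suc b) 1             = suc (mediumSmallBins b 0)
mediumSmallBins (suc b) (suc (suc c)) = suc (mediumSmallBins b c)

mediumSmallBins-≤ : ∀ b c → mediumSmallBins b c ≤ b ℕ.+ ⌈ c ∸ (b ℕ.+ b) /3⌉
mediumSmallBins-≤ 0       c             = ℕP.≤-refl
mediumSmallBins-≤ (suc b) 0             =
  ℕ.s≤s (subst (λ z → mediumSmallBins b 0 ≤ b ℕ.+ ⌈ z /3⌉) (ℕP.0∸n≡0 (b ℕ.+ b)) (mediumSmallBins-≤ b 0))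
mediumSmallBins-≤ (suc b) 1             rewrite ℕP.0∸n≡0 (b ℕ.+ suc b) =
  ℕ.s≤s (subst (λ z → mediumSmallBins b 0 ≤ b ℕ.+ ⌈ z /3⌉) (ℕP.0∸n≡0 (b ℕ.+ b)) (mediumSmallBins-≤ b 0))
mediumSmallBins-≤ (suc b) (suc (suc c)) rewrite ℕP.+-suc b b = ℕ.s≤s (mediumSmallBins-≤ b c)

L M S : ℚ
L = size large
M = size medium
S = size small

Packing-smalls : ∀ c → Packing ⌈ c /3⌉ (List.replicate c S)
Packing-smalls 0                 = Packing-[]
Packing-smalls 1                 = Packing-bin (S ∷ []) (ℚP.≤ᵇ⇒≤ tt) Packing-[]
Packing-smalls 2                 = Packing-bin (S ∷ S ∷ []) (ℚP.≤ᵇ⇒≤ tt) Packing-[]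
Packing-smalls (suc (suc (suc c))) = Packing-bin (S ∷ S ∷ S ∷ []) (ℚP.≤ᵇ⇒≤ tt) (Packing-smalls c)

Packing-mediums-smalls : ∀ b c → Packing (mediumSmallBins b c) (List.replicate b M ++ List.replicate c S)
Packing-mediums-smalls 0       c             = Packing-smalls c
Packing-mediums-smalls (suc b) 0             = Packing-bin (M ∷ []) (ℚP.≤ᵇ⇒≤ tt) (Packing-mediums-smalls b 0)
Packing-mediums-smalls (suc b) 1             =
  Packing-↭ (↭-sym (↭.prep M (shift S (List.replicate b M) [])))
    (Packing-bin (M ∷ S ∷ []) (ℚP.≤ᵇ⇒≤ tt) (Packing-mediums-smalls b 0))
Packing-mediums-smalls (suc b) (suc (suc c)) =
  Packing-↭ (↭-sym (↭.prep M (↭.trans (shift S Ms (S ∷ Ss)) (↭.prep S (shift S Ms Ss)))))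
    (Packing-bin (M ∷ S ∷ S ∷ []) (ℚP.≤ᵇ⇒≤ tt) (Packing-mediums-smalls b c))
  where
  Ms Ss : List ℚ
  Ms = List.replicate b M
  Ss = List.replicate c S

Packing-sorted : ∀ a b c → Packing (⌈ a /2⌉ ℕ.+ mediumSmallBins b c)
                                   (List.replicate a L ++ (List.replicate b M ++ List.replicate c S))
Packing-sorted 0             b c = Packing-mediums-smalls b c
Packing-sorted 1             b c = Packing-bin (L ∷ []) (ℚP.≤ᵇ⇒≤ tt) (Packing-mediums-smalls b c)
Packing-sorted (suc (suc a)) b c = Packing-bin (L ∷ L ∷ []) (ℚP.≤ᵇ⇒≤ tt) (Packing-sorted a b c)

sortedItems : ∀ {n} → Sample n → List ℚ
sortedItems σ = List.replicate (occurrences large σ) L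
             ++ (List.replicate (occurrences medium σ) M ++ List.replicate (occurrences small σ) S)

items↭sortedItems : ∀ {n} (σ : Sample n) → toList (Vec.map size σ) ↭ sortedItems σ
items↭sortedItems []           = ↭.refl
items↭sortedItems (large ∷ σ)  = ↭.prep L (items↭sortedItems σ)
items↭sortedItems (medium ∷ σ) = ↭.trans (↭.prep M (items↭sortedItems σ)) (↭-sym (shift M Ls (Ms ++ Ss)))
  where
  Ls Ms Ss : List ℚ
  Ls = List.replicate (occurrences large σ) L
  Ms = List.replicate (occurrences medium σ) M
  Ss = List.replicate (occurrences small σ) S
items↭sortedItems (small ∷ σ)  = ↭.trans (↭.prep S (items↭sortedItems σ))
  (subst₂ _↭_ (cong (S ∷_) (ListP.++-assoc Ls Ms Ss)) (ListP.++-assoc Ls Ms (S ∷ Ss)) (↭-sym (shift S (Ls ++ Ms) Ss)))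
  where
  Ls Ms Ss : List ℚ
  Ls = List.replicate (occurrences large σ) L
  Ms = List.replicate (occurrences medium σ) M
  Ss = List.replicate (occurrences small σ) S

OPT-≤-greedy : ∀ {n} (σ : Sample n) →
  OPT (Vec.map size σ) ≤ ⌈ occurrences large σ /2⌉ ℕ.+ mediumSmallBins (occurrences medium σ) (occurrences small σ)
OPT-≤-greedy σ = OPT-≤-Packing (Vec.map size σ)
  (Packing-↭ (↭-sym (items↭sortedItems σ)) (Packing-sorted (occurrences large σ) (occurrences medium σ) (occurrences small σ)))

smallSurplus : Fin 3 → ℚ
smallSurplus k = indicator small k + (- (+ 2 / 1)) * indicator medium k

smallSurplus-sum : ∀ {n} (σ : Sample n) →
  toℚ (occurrences small σ) - toℚ (occurrences medium σ ℕ.+ occurrences medium σ) ≡ sampleSum smallSurplus σ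
smallSurplus-sum σ = begin
  toℚ c - toℚ (b ℕ.+ b)                   ≡⟨ cong (λ e → toℚ c - e) (toℚ-+ b b) ⟩
  toℚ c - (toℚ b + toℚ b)                 ≡⟨ solve 2 (λ c b → c :- (b :+ b) := c :+ con (- (+ 2 / 1)) :* b) refl (toℚ c) (toℚ b) ⟩
  toℚ c + (- (+ 2 / 1)) * toℚ b           ≡⟨ cong₂ (λ u v → u + (- (+ 2 / 1)) * v) (toℚ-occurrences small σ) (toℚ-occurrences medium σ) ⟩
  sampleSum (indicator small) σ + (- (+ 2 / 1)) * sampleSum (indicator medium) σ
    ≡⟨ cong (λ e → sampleSum (indicator small) σ + e) (sym (sampleSum-*ˡ (- (+ 2 / 1)) (indicator medium) σ)) ⟩
  sampleSum (indicator small) σ + sampleSum (λ k → (- (+ 2 / 1)) * indicator medium k) σ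
    ≡⟨ sym (sampleSum-+ (indicator small) (λ k → (- (+ 2 / 1)) * indicator medium k) σ) ⟩
  sampleSum smallSurplus σ                ∎
  where
  open ≡-Reasoning
  b c : ℕ
  b = occurrences medium σ
  c = occurrences small σ

-- The truncated surplus (c ∸ 2b) is bounded by ∸-≤-square with K = 100, whose expectation only
-- needs the first two moments of smallSurplus.
optBound : ∀ {n} → Sample n → ℚ
optBound σ = (+ 1 / 2) * sampleSum (indicator large) σ
           + (sampleSum (indicator medium) σ + ((+ 1 / 1200) * ((surplus + + 100 / 1) * (surplus + + 100 / 1)) + + 7 / 6))
  where
  surplus : ℚ
  surplus = sampleSum smallSurplus σ

toℚ-OPT-≤-optBound : ∀ {n} (σ : Sample n) → toℚ (OPT (Vec.map size σ)) ≤ℚ optBound σ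
toℚ-OPT-≤-optBound σ = begin
  toℚ (OPT (Vec.map size σ))
    ≤⟨ toℚ-mono (ℕP.≤-trans (OPT-≤-greedy σ) (ℕP.+-monoʳ-≤ ⌈ a /2⌉ (mediumSmallBins-≤ b c))) ⟩
  toℚ (⌈ a /2⌉ ℕ.+ (b ℕ.+ ⌈ d /3⌉))
    ≡⟨ trans (toℚ-+ ⌈ a /2⌉ _) (cong (λ e → toℚ ⌈ a /2⌉ + e) (toℚ-+ b ⌈ d /3⌉)) ⟩
  toℚ ⌈ a /2⌉ + (β + toℚ ⌈ d /3⌉)
    ≤⟨ ℚP.+-mono-≤ (toℚ-≤-half {⌈ a /2⌉} (⌈n/2⌉+⌈n/2⌉≤1+n a)) (ℚP.+-monoʳ-≤ β (toℚ-≤-third {⌈ d /3⌉} (⌈n/3⌉*3≤2+n d))) ⟩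
  (+ 1 / 2) * toℚ (1 ℕ.+ a) + (β + (+ 1 / 3) * toℚ (2 ℕ.+ d))
    ≡⟨ cong₂ (λ u v → (+ 1 / 2) * u + (β + (+ 1 / 3) * v)) (toℚ-+ 1 a) (toℚ-+ 2 d) ⟩
  (+ 1 / 2) * (1ℚ + α) + (β + (+ 1 / 3) * (toℚ 2 + δ))
    ≡⟨ solve 3 (λ a b d → con (+ 1 / 2) :* (con 1ℚ :+ a) :+ (b :+ con (+ 1 / 3) :* (con (toℚ 2) :+ d))
                        := con (+ 1 / 2) :* a :+ (b :+ (con (+ 1 / 3) :* d :+ con (+ 7 / 6)))) refl α β δ ⟩
  (+ 1 / 2) * α + (β + ((+ 1 / 3) * δ + + 7 / 6))
    ≤⟨ ℚP.+-monoʳ-≤ ((+ 1 / 2) * α) (ℚP.+-monoʳ-≤ β (ℚP.+-monoˡ-≤ (+ 7 / 6) surplus-bound)) ⟩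
  (+ 1 / 2) * α + (β + ((+ 1 / 1200) * ((γ + + 100 / 1) * (γ + + 100 / 1)) + + 7 / 6))
    ≡⟨ cong₂ (λ u v → (+ 1 / 2) * u + v) (toℚ-occurrences large σ)
         (cong₂ (λ v w → v + ((+ 1 / 1200) * ((w + + 100 / 1) * (w + + 100 / 1)) + + 7 / 6))
                (toℚ-occurrences medium σ) (smallSurplus-sum σ)) ⟩
  optBound σ ∎
  where
  open ℚP.≤-Reasoning
  a b c d : ℕ
  a = occurrences large σ
  b = occurrences medium σ
  c = occurrences small σ
  d = c ∸ (b ℕ.+ b)
  α β δ γ : ℚ
  α = toℚ a
  β = toℚ b
  δ = toℚ d
  γ = toℚ c - toℚ (b ℕ.+ b)
  surplus-bound : (+ 1 / 3) * δ ≤ℚ (+ 1 / 1200) * ((γ + + 100 / 1) * (γ + + 100 / 1))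
  surplus-bound = subst (_≤ℚ (+ 1 / 1200) * ((γ + + 100 / 1) * (γ + + 100 / 1)))
    (solve 1 (λ x → con (+ 1 / 1200) :* (con (+ 4 / 1) :* con (+ 100 / 1) :* x) := con (+ 1 / 3) :* x) refl δ)
    (*-monoˡ-≤-nonNeg {+ 1 / 1200} (ℚP.≤ᵇ⇒≤ tt) (∸-≤-square (+ 100 / 1) c (b ℕ.+ b)))

𝔼-optBound : ∀ n → 𝔼 n optBound ≡ toℚ n * (+ 39 / 100) + + 19 / 2
𝔼-optBound n = begin
  𝔼 n optBound
    ≡⟨ 𝔼-+ n (λ σ → (+ 1 / 2) * count-large σ) (λ σ → count-medium σ + rest σ) ⟩
  𝔼 n (λ σ → (+ 1 / 2) * count-large σ) + 𝔼 n (λ σ → count-medium σ + rest σ)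
    ≡⟨ cong₂ _+_ (𝔼-*ˡ n (+ 1 / 2) count-large) (𝔼-+ n count-medium rest) ⟩
  (+ 1 / 2) * 𝔼 n count-large + (𝔼 n count-medium + 𝔼 n rest)
    ≡⟨ cong₂ (λ u v → (+ 1 / 2) * u + v) (𝔼-sampleSum (indicator large) n)
             (cong₂ _+_ (𝔼-sampleSum (indicator medium) n) 𝔼-rest) ⟩
  (+ 1 / 2) * (t * (+ 1 / 3)) + (t * (+ 2 / 9) + ((+ 1 / 1200) * (t * (+ 4 / 3) + + 10000 / 1) + + 7 / 6))
    ≡⟨ solve 1 (λ t → con (+ 1 / 2) :* (t :* con (+ 1 / 3))
                       :+ (t :* con (+ 2 / 9) :+ (con (+ 1 / 1200) :* (t :* con (+ 4 / 3) :+ con (+ 10000 / 1)) :+ con (+ 7 / 6)))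
                     := t :* con (+ 39 / 100) :+ con (+ 19 / 2)) refl t ⟩
  t * (+ 39 / 100) + + 19 / 2 ∎
  where
  open ≡-Reasoning
  t : ℚ
  t = toℚ n
  count-large count-medium surplus square rest : Sample n → ℚ
  count-large  = sampleSum (indicator large)
  count-medium = sampleSum (indicator medium)
  surplus      = sampleSum smallSurplus
  square σ     = (surplus σ + + 100 / 1) * (surplus σ + + 100 / 1)
  rest σ       = (+ 1 / 1200) * square σ + + 7 / 6
  𝔼-square : 𝔼 n square ≡ t * (+ 4 / 3) + + 10000 / 1
  𝔼-square = begin
    𝔼 n square
      ≡⟨ 𝔼-cong n (λ σ → solve 1 (λ x → (x :+ con (+ 100 / 1)) :* (x :+ con (+ 100 / 1))
                                     := x :* x :+ (con (+ 200 / 1) :* x :+ con (+ 10000 / 1))) refl (surplus σ)) ⟩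
    𝔼 n (λ σ → surplus σ * surplus σ + ((+ 200 / 1) * surplus σ + + 10000 / 1))
      ≡⟨ 𝔼-+ n (λ σ → surplus σ * surplus σ) (λ σ → (+ 200 / 1) * surplus σ + + 10000 / 1) ⟩
    𝔼 n (λ σ → surplus σ * surplus σ) + 𝔼 n (λ σ → (+ 200 / 1) * surplus σ + + 10000 / 1)
      ≡⟨ cong₂ _+_ (𝔼-sampleSum² smallSurplus refl n)
                   (trans (𝔼-+ n (λ σ → (+ 200 / 1) * surplus σ) (λ _ → + 10000 / 1))
                          (cong₂ _+_ (trans (𝔼-*ˡ n (+ 200 / 1) surplus) (cong ((+ 200 / 1) *_) (𝔼-sampleSum smallSurplus n)))
                                     (𝔼-const n (+ 10000 / 1)))) ⟩
    t * (+ 4 / 3) + ((+ 200 / 1) * (t * 0ℚ) + + 10000 / 1)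
      ≡⟨ solve 1 (λ t → t :* con (+ 4 / 3) :+ (con (+ 200 / 1) :* (t :* con 0ℚ) :+ con (+ 10000 / 1))
                       := t :* con (+ 4 / 3) :+ con (+ 10000 / 1)) refl t ⟩
    t * (+ 4 / 3) + + 10000 / 1 ∎
  𝔼-rest : 𝔼 n rest ≡ (+ 1 / 1200) * (t * (+ 4 / 3) + + 10000 / 1) + + 7 / 6
  𝔼-rest = trans (𝔼-+ n (λ σ → (+ 1 / 1200) * square σ) (λ _ → + 7 / 6))
                 (cong₂ _+_ (trans (𝔼-*ˡ n (+ 1 / 1200) square) (cong ((+ 1 / 1200) *_) 𝔼-square)) (𝔼-const n (+ 7 / 6)))

E[OPT]-≤ : ∀ n → E[_] {n} 𝓕 OPT ≤ℚ toℚ n * (+ 39 / 100) + + 19 / 2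
E[OPT]-≤ n = ℚP.≤-trans (𝔼-mono n toℚ-OPT-≤-optBound) (ℚP.≤-reflexive (𝔼-optBound n))

lemma15 : Σ FinDist λ F → (∀ i → (+ 1 / 4) ≤ℚ val F i) × ∃ λ N → ∀ n → N ≤ n → ((+ 11 / 10) * E[_] {n} F OPT) < E[_] {n} F BFᵥ
lemma15 = 𝓕 , quarter≤size , 30000 , separation
  where
  separation : ∀ n → 30000 ≤ n → (+ 11 / 10) * E[_] {n} 𝓕 OPT < E[_] {n} 𝓕 BFᵥ
  separation n 30000≤n = begin-strict
    (+ 11 / 10) * E[_] {n} 𝓕 OPT                   ≤⟨ *-monoˡ-≤-nonNeg {+ 11 / 10} (ℚP.≤ᵇ⇒≤ tt) (E[OPT]-≤ n) ⟩
    (+ 11 / 10) * (t * (+ 39 / 100) + + 19 / 2)      ≡⟨ solve 1 (λ t → con (+ 11 / 10) :* (t :* con (+ 39 / 100) :+ con (+ 19 / 2))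
                                                                  := t :* con (+ 429 / 1000) :+ con (+ 209 / 20)) refl t ⟩
    t * (+ 429 / 1000) + + 209 / 20                 <⟨ ℚP.+-monoʳ-< (t * (+ 429 / 1000)) constant<slack ⟩
    t * (+ 429 / 1000) + t * (+ 1 / 2500)           ≡⟨ sym (ℚP.*-distribˡ-+ t (+ 429 / 1000) (+ 1 / 2500)) ⟩
    t * bfRate                                      ≤⟨ E[BF]-≥ n ⟩
    E[_] {n} 𝓕 BFᵥ                                  ∎
    where
    open ℚP.≤-Reasoning
    t : ℚ
    t = toℚ n
    constant<slack : + 209 / 20 < t * (+ 1 / 2500)
    constant<slack = ℚP.<-≤-trans (toWitness {a? = + 209 / 20 ℚP.<? toℚ 30000 * (+ 1 / 2500)} tt)
                                  (ℚP.*-monoʳ-≤-nonNeg (+ 1 / 2500) (toℚ-mono 30000≤n))
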